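{- Let $g$ be an odd integer, let $G$ be a finite graph of odd girth at least $g$, and let $C$ be a shortest odd cycle in $G$. Let $t\le (g-1)/2$ be a non-negative integer, and suppose that every vertex of $G$ is at distance at most $t$ from $V(C)$. Let $z$ be a vertex of $C$, let $A$ denote the set of vertices of $C$ at distance at most $t$ from $z$, and let $R$ be the set of vertices of $G$ at distance at most $t$ from $A$. Then $G-R$ is bipartite.
   Context: The odd girth of a graph is the length of a shortest odd cycle in it. Distances are graph distances in $G$; the distance from a vertex to a set of vertices is the minimum distance to a vertex of the set. $G-R$ denotes the subgraph of $G$ induced by $V(G)\setminus R$. -}

module Defs where

open import Data.Nat using (ℕ; zero; suc; _+_; _*_; _≤_)
open import Data.Fin using (Fin; inject₁; fromℕ) renaming (zero to fzero; suc to fsuc)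
open import Data.Bool using (Bool)
open import Data.Product using (Σ; ∃; ∃-syntax; _×_; _,_)
open import Relation.Nullary using (¬_)
open import Relation.Binary.PropositionalEquality using (_≡_; _≢_)
open import Function.Definitions using (Injective)

Odd : ℕ → Set
Odd n = ∃[ k ] n ≡ suc (2 * k)

record SimpleGraph (V : Set) : Set₁ where
  field
    Adj     : V → V → Set
    sym     : ∀ {u v} → Adj u v → Adj v u
    irrefl  : ∀ {v} → ¬ Adj v v
open SimpleGraph public

module _ {V : Set} (G : SimpleGraph V) where

  data Walk : V → V → ℕ → Set where
    nil  : ∀ {u} → Walk u u 0
    cons : ∀ {u w v k} → Adj G u w → Walk w v k → Walk u v (suc k)

  -- dist_G(u,v) ≤ k  (the distance is the least length of a u-v walk)
  DistLe : V → V → ℕ → Set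
  DistLe u v k = ∃[ m ] (m ≤ k × Walk u v m)

  record Cycle : Set where
    field
      m       : ℕ
      len≥3   : 3 ≤ suc m
      vtx     : Fin (suc m) → V
      inj     : Injective _≡_ _≡_ vtx
      step    : ∀ (i : Fin m) → Adj G (vtx (inject₁ i)) (vtx (fsuc i))
      close   : Adj G (vtx (fromℕ m)) (vtx fzero)
    len : ℕ
    len = suc m

  open Cycle public

  -- odd girth at least g (vacuous if there is no odd cycle)
  OddGirth≥ : ℕ → Set
  OddGirth≥ g = ∀ (D : Cycle) → Odd (len D) → g ≤ len D

  ShortestOddCycle : Cycle → Set
  ShortestOddCycle C = Odd (len C) × (∀ (D : Cycle) → Odd (len D) → len C ≤ len D)

  OnCycle : Cycle → V → Set
  OnCycle C v = ∃[ j ] vtx C j ≡ v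

  DistSetLe : (V → Set) → V → ℕ → Set
  DistSetLe S v k = ∃[ s ] (S s × DistLe s v k)

  deleteSet : (R : V → Set) → SimpleGraph (Σ V (λ v → ¬ R v))
  deleteSet R = record
    { Adj = λ { (u , _) (v , _) → Adj G u v }
    ; sym = λ { {u , _} {v , _} e → sym G e }
    ; irrefl = λ { {v , _} e → irrefl G e } }

Bipartite : {V : Set} → SimpleGraph V → Set
Bipartite {V} H = Σ (V → Bool) (λ c → ∀ (u v : V) → Adj H u v → c u ≢ c v)

module Submission where

-- Each vertex v has a foot on C at distance depth v ≤ t, lying position v steps along C
-- after z. Outside R we have t < position v and position v + t < |C|, since otherwise v
-- would be within t of a vertex of A. Colour v by the parity of position v + depth v.
-- A monochromatic edge uv outside R, with position u ≤ position v, gives a closed walk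
-- (the arc of C from foot u to foot v, the leg up to v, the edge vu, the leg back to
-- foot u) of odd length less than |C|. Shortening it to a path while keeping its parity
-- must expose an odd cycle no longer than the walk, contradicting the minimality of C.

open import Defs
open import Data.Bool using (Bool; true; false)
open import Data.Empty using (⊥-elim)
open import Data.Fin using (Fin; toℕ; fromℕ; fromℕ<; inject₁) renaming (zero to fzero; suc to fsuc)
open import Data.Fin.Properties using (toℕ-injective; toℕ-fromℕ; toℕ-fromℕ<; toℕ-inject₁; toℕ<n; toℕ≤pred[n])
import Data.Fin.Properties as Fin
open import Data.Nat using (ℕ; NonZero; zero; suc; _+_; _*_; _∸_; _≤_; _<_; z≤n; s≤s; s≤s⁻¹; _<?_; _≤?_; anyUpTo?; parity)
open import Data.Nat.DivMod using (_/_; _%_; _mod_; m≡m%n+[m/n]*n; [m+kn]%n≡m%n; [m+n]%n≡m%n; m<n⇒m%n≡m; m≤n⇒m%n≡m; m%n<n; n%n≡0)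
open import Data.Nat.Properties
  using (+-comm; +-assoc; +-identityʳ; <-≤-trans; *-suc; +-suc; ≤-refl; ≤-trans; ≤-<-trans; <⇒≤; ≤-antisym; ≤-total; ≮⇒≥; ≰⇒>; <-irrefl;
         m≤n⇒m≤1+n; m∸n≤m; m∸n+n≡m; m+[n∸m]≡n; m≤n+o⇒m∸n≤o; +-mono-≤; +-monoʳ-≤; +-monoˡ-<; +-cancelˡ-≡; module ≤-Reasoning)
open import Data.Nat.Tactic.RingSolver using (solve-∀)
open import Data.Parity.Base as ℙ using (Parity; 0ℙ; 1ℙ; _⁻¹)
open import Data.Parity.Properties using (+-homo-+; p+p≡0ℙ; ⁻¹-involutive) renaming (+-cancelˡ-≡ to +ℙ-cancelˡ-≡)
open import Data.Product using (Σ; ∃-syntax; _×_; _,_; proj₁; proj₂)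
open import Data.Sum using (_⊎_; inj₁; inj₂)
open import Relation.Binary.Definitions using (DecidableEquality)
open import Relation.Binary.PropositionalEquality using (_≡_; _≢_; refl; cong; subst; subst₂; trans; module ≡-Reasoning)
import Relation.Binary.PropositionalEquality as Eq
open import Relation.Nullary using (¬_; yes; no)

[1+m]%n≡[1+m%n]%n : ∀ m n .{{_ : NonZero n}} → suc m % n ≡ suc (m % n) % n
[1+m]%n≡[1+m%n]%n m n = begin
  suc m % n                         ≡⟨ cong (λ y → suc y % n) (m≡m%n+[m/n]*n m n) ⟩
  (suc (m % n) + (m / n) * n) % n   ≡⟨ [m+kn]%n≡m%n (suc (m % n)) (m / n) n ⟩
  suc (m % n) % n                   ∎
  where open ≡-Reasoning

parity-suc : ∀ n → parity (suc n) ≡ parity n ⁻¹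
parity-suc n = +-homo-+ 1 n

parity≡1ℙ⇒odd : ∀ n → parity n ≡ 1ℙ → Odd n
parity≡1ℙ⇒odd (suc zero) _ = 0 , refl
parity≡1ℙ⇒odd (suc (suc n)) p with parity≡1ℙ⇒odd n p
... | k , refl = suc k , cong suc (Eq.sym (*-suc 2 k))

parity-cancelˡ : ∀ m a b → parity (m + a) ≡ parity (m + b) → parity a ≡ parity b
parity-cancelˡ m a b eq = +ℙ-cancelˡ-≡ (parity m) (parity a) (parity b)
  (trans (Eq.sym (+-homo-+ m a)) (trans eq (+-homo-+ m b)))

parity[1+m+n]≡1ℙ : ∀ m n → parity m ≡ parity n → parity (suc (m + n)) ≡ 1ℙ
parity[1+m+n]≡1ℙ m n eq = begin
  parity (suc (m + n))         ≡⟨ parity-suc (m + n) ⟩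
  parity (m + n) ⁻¹            ≡⟨ cong _⁻¹ (+-homo-+ m n) ⟩
  (parity m ℙ.+ parity n) ⁻¹   ≡⟨ cong (λ p → (p ℙ.+ parity n) ⁻¹) eq ⟩
  (parity n ℙ.+ parity n) ⁻¹   ≡⟨ cong _⁻¹ (p+p≡0ℙ (parity n)) ⟩
  1ℙ                           ∎
  where open ≡-Reasoning

parity-suc-cong : ∀ m n → parity m ≡ parity n → parity (suc m) ≡ parity (suc n)
parity-suc-cong m n eq = trans (parity-suc m) (trans (cong _⁻¹ eq) (Eq.sym (parity-suc n)))

parity[k∸r]≡parity[1+k] : ∀ {r k} → r ≤ k → parity r ≡ 1ℙ → parity (k ∸ r) ≡ parity (suc k)
parity[k∸r]≡parity[1+k] {r} {k} r≤k odd = begin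
  parity x                        ≡⟨ Eq.sym (⁻¹-involutive (parity x)) ⟩
  (1ℙ ℙ.+ parity x) ⁻¹            ≡⟨ cong (λ p → (p ℙ.+ parity x) ⁻¹) (Eq.sym odd) ⟩
  (parity r ℙ.+ parity x) ⁻¹      ≡⟨ cong _⁻¹ (Eq.sym (+-homo-+ r x)) ⟩
  parity (r + x) ⁻¹               ≡⟨ Eq.sym (parity-suc (r + x)) ⟩
  parity (suc (r + x))            ≡⟨ cong (λ y → parity (suc y)) (m+[n∸m]≡n r≤k) ⟩
  parity (suc k)                  ∎
  where
  open ≡-Reasoning
  x = k ∸ r

parity-detour≡1ℙ : ∀ p x d d′ → parity (p + d) ≡ parity ((x + p) + d′) → parity (x + (d′ + suc d)) ≡ 1ℙ
parity-detour≡1ℙ p x d d′ same = begin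
  parity (x + (d′ + suc d))   ≡⟨ cong parity (rearrange x d′ d) ⟩
  parity (suc (x + d′ + d))   ≡⟨ parity[1+m+n]≡1ℙ (x + d′) d (Eq.sym (parity-cancelˡ p d (x + d′) balanced)) ⟩
  1ℙ                          ∎
  where
  open ≡-Reasoning
  rearrange : ∀ x d′ d → x + (d′ + suc d) ≡ suc (x + d′ + d)
  rearrange = solve-∀
  swap : ∀ x p d′ → (x + p) + d′ ≡ p + (x + d′)
  swap = solve-∀
  balanced : parity (p + d) ≡ parity (p + (x + d′))
  balanced = trans same (cong parity (swap x p d′))

detour-length< : ∀ {p q x d d′ t L} → x + p ≡ q → t < p → q + t < L → d ≤ t → d′ ≤ t → x + (d′ + suc d) < L
detour-length< {p} {q} {x} {d} {d′} {t} {L} x+p≡q t<p q+t<L d≤t d′≤t = begin-strict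
  x + (d′ + suc d)   ≤⟨ +-monoʳ-≤ x (+-mono-≤ d′≤t (≤-trans (s≤s d≤t) t<p)) ⟩
  x + (t + p)        ≡⟨ swap x t p ⟩
  (x + p) + t        ≡⟨ cong (_+ t) x+p≡q ⟩
  q + t              <⟨ q+t<L ⟩
  L                  ∎
  where
  open ≤-Reasoning
  swap : ∀ x t p → x + (t + p) ≡ (x + p) + t
  swap = solve-∀

module Walks {V : Set} (G : SimpleGraph V) where

  infixr 5 _++_
  infixl 5 _∷ʳ_

  _∷ʳ_ : ∀ {u v w k} → Walk G u v k → Adj G v w → Walk G u w (suc k)
  nil ∷ʳ e = cons e nil
  cons e′ p ∷ʳ e = cons e′ (p ∷ʳ e)

  _++_ : ∀ {u v w k l} → Walk G u v k → Walk G v w l → Walk G u w (k + l)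
  nil ++ q = q
  cons e p ++ q = cons e (p ++ q)

  reverse : ∀ {u v k} → Walk G u v k → Walk G v u k
  reverse nil = nil
  reverse (cons e p) = reverse p ∷ʳ sym G e

module Paths {V : Set} (G : SimpleGraph V) (_≟_ : DecidableEquality V) where

  record Path (u v : V) (k : ℕ) : Set where
    field
      vert      : ℕ → V
      starts    : vert 0 ≡ u
      ends      : vert k ≡ v
      steps     : ∀ x → x < k → Adj G (vert x) (vert (suc x))
      injective : ∀ x y → x ≤ k → y ≤ k → vert x ≡ vert y → x ≡ y
  open Path

  OddCycle≤ : ℕ → Set
  OddCycle≤ k = Σ (Cycle G) λ D → Odd (len D) × len D ≤ k

  SameParityPath≤ : V → V → ℕ → Set
  SameParityPath≤ u v k = ∃[ k′ ] k′ ≤ k × parity k′ ≡ parity k × Path u v k′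

  trivialPath : ∀ u → Path u u 0
  trivialPath u = record
    { vert = λ _ → u ; starts = refl ; ends = refl ; steps = λ _ ()
    ; injective = λ { _ _ z≤n z≤n _ → refl } }

  prefix : ∀ {u v k} (P : Path u v k) r → r ≤ k → Path u (vert P r) r
  prefix P r r≤k = record
    { vert = vert P ; starts = starts P ; ends = refl
    ; steps = λ x x<r → steps P x (≤-trans x<r r≤k)
    ; injective = λ x y x≤r y≤r → injective P x y (≤-trans x≤r r≤k) (≤-trans y≤r r≤k) }

  suffix : ∀ {u v k} (P : Path u v k) r → r ≤ k → Path (vert P r) v (k ∸ r)
  suffix {k = k} P r r≤k = record
    { vert = λ x → vert P (r + x)
    ; starts = cong (vert P) (+-identityʳ r)
    ; ends = trans (cong (vert P) (m+[n∸m]≡n r≤k)) (ends P)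
    ; steps = λ x x<k∸r → subst (λ y → Adj G (vert P (r + x)) (vert P y)) (Eq.sym (+-suc r x))
                (steps P (r + x) (subst (_≤ k) (+-suc r x) (shift (suc x) x<k∸r)))
    ; injective = λ x y x≤ y≤ eq → +-cancelˡ-≡ r x y (injective P (r + x) (r + y) (shift x x≤) (shift y y≤) eq) }
    where
    shift : ∀ x → x ≤ k ∸ r → r + x ≤ k
    shift x x≤k∸r = subst (r + x ≤_) (m+[n∸m]≡n r≤k) (+-monoʳ-≤ r x≤k∸r)

  prepend : ∀ {u w v k} → Adj G u w → (P : Path w v k) → (∀ x → x ≤ k → vert P x ≢ u) → Path u v (suc k)
  prepend {u} {k = k} e P u∉P = record
    { vert = vert′ ; starts = refl ; ends = ends P ; steps = steps′ ; injective = injective′ }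
    where
    vert′ : ℕ → _
    vert′ zero = u
    vert′ (suc x) = vert P x
    steps′ : ∀ x → x < suc k → Adj G (vert′ x) (vert′ (suc x))
    steps′ zero _ = subst (Adj G u) (Eq.sym (starts P)) e
    steps′ (suc x) (s≤s x<k) = steps P x x<k
    injective′ : ∀ x y → x ≤ suc k → y ≤ suc k → vert′ x ≡ vert′ y → x ≡ y
    injective′ zero zero _ _ _ = refl
    injective′ zero (suc y) _ (s≤s y≤k) eq = ⊥-elim (u∉P y y≤k (Eq.sym eq))
    injective′ (suc x) zero (s≤s x≤k) _ eq = ⊥-elim (u∉P x x≤k eq)
    injective′ (suc x) (suc y) (s≤s x≤k) (s≤s y≤k) eq = cong suc (injective P x y x≤k y≤k eq)

  closePath : ∀ {u w r} → Path w u (suc (suc r)) → Adj G u w → Cycle G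
  closePath {r = r} P e = record
    { m = suc (suc r)
    ; len≥3 = s≤s (s≤s (s≤s z≤n))
    ; vtx = λ x → vert P (toℕ x)
    ; inj = λ {a} {b} eq → toℕ-injective (injective P (toℕ a) (toℕ b) (toℕ≤pred[n] a) (toℕ≤pred[n] b) eq)
    ; step = λ x → subst (λ y → Adj G (vert P y) (vert P (suc (toℕ x)))) (Eq.sym (toℕ-inject₁ x))
                     (steps P (toℕ x) (toℕ<n x))
    ; close = subst₂ (Adj G) (Eq.sym (trans (cong (vert P) (toℕ-fromℕ (suc (suc r)))) (ends P))) (Eq.sym (starts P)) e
    }

  closeOddCycle : ∀ {u w v k} → Adj G u w → (P : Path w v k) →
                  ∀ r → r ≤ k → vert P r ≡ u → parity r ≡ 0ℙ → OddCycle≤ (suc k)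
  closeOddCycle e P zero _ r≡u _ = ⊥-elim (irrefl G (subst (Adj G _) (trans (Eq.sym (starts P)) r≡u) e))
  closeOddCycle e P (suc zero) _ _ ()
  closeOddCycle e P (suc (suc r)) r≤k r≡u even =
    closePath (prefix P (suc (suc r)) r≤k) (subst (λ y → Adj G y _) (Eq.sym r≡u) e) ,
    parity≡1ℙ⇒odd (suc (suc (suc r))) (trans (parity-suc (suc (suc r))) (cong _⁻¹ even)) ,
    s≤s r≤k

  -- u reappears at index r of P: the prefix up to r closes into a cycle of length r + 1,
  -- and if that length is even, cutting the prefix off preserves the parity.
  revisit : ∀ {u w v k′ k} → Adj G u w → (P : Path w v k′) → k′ ≤ k → parity k′ ≡ parity k →
            ∀ r → r ≤ k′ → vert P r ≡ u → OddCycle≤ (suc k) ⊎ SameParityPath≤ u v (suc k)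
  revisit {v = v} {k′} {k} e P k′≤k same r r≤k′ r≡u with parity r in eq
  ... | 0ℙ = let (D , odd , D≤) = closeOddCycle e P r r≤k′ r≡u eq in inj₁ (D , odd , ≤-trans D≤ (s≤s k′≤k))
  ... | 1ℙ = inj₂ (k′ ∸ r , ≤-trans (m∸n≤m k′ r) (m≤n⇒m≤1+n k′≤k) ,
                  trans (parity[k∸r]≡parity[1+k] r≤k′ eq) (parity-suc-cong k′ k same) ,
                  subst (λ y → Path y v (k′ ∸ r)) r≡u (suffix P r r≤k′))

  walk⇒path⊎oddCycle : ∀ {u v k} → Walk G u v k → OddCycle≤ k ⊎ SameParityPath≤ u v k
  walk⇒path⊎oddCycle {u} nil = inj₂ (0 , z≤n , refl , trivialPath u)
  walk⇒path⊎oddCycle {u} {k = suc k} (cons e p) with walk⇒path⊎oddCycle p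
  ... | inj₁ (D , odd , D≤k) = inj₁ (D , odd , m≤n⇒m≤1+n D≤k)
  ... | inj₂ (k′ , k′≤k , same , P) with anyUpTo? (λ x → vert P x ≟ u) (suc k′)
  ...   | yes (r , s≤s r≤k′ , r≡u) = revisit e P k′≤k same r r≤k′ r≡u
  ...   | no u∉P = inj₂ (suc k′ , s≤s k′≤k , parity-suc-cong k′ k same ,
                         prepend e P λ x x≤k′ x≡u → u∉P (x , s≤s x≤k′ , x≡u))

  closedWalk⇒oddCycle : ∀ {u k} → Walk G u u k → parity k ≡ 1ℙ → OddCycle≤ k
  closedWalk⇒oddCycle w odd with walk⇒path⊎oddCycle w
  ... | inj₁ D = D
  ... | inj₂ (k′ , _ , same , P) with injective P 0 k′ z≤n ≤-refl (trans (starts P) (Eq.sym (ends P)))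
  ...   | refl with trans same odd
  ...     | ()

module Unrolling {V : Set} {G : SimpleGraph V} (C : Cycle G) (i : Fin (len C)) where

  open Walks G

  at : ℕ → V
  at k = vtx C (k mod len C)

  at≡vtx : ∀ k (j : Fin (len C)) → k % len C ≡ toℕ j → at k ≡ vtx C j
  at≡vtx k j eq = cong (vtx C) (toℕ-injective (trans (toℕ-fromℕ< _) eq))

  at-adj : ∀ k → Adj G (at k) (at (suc k))
  at-adj k with k % len C <? m C
  ... | yes r<m = subst₂ (Adj G) (Eq.sym at-k) (Eq.sym at-suc-k) (step C j)
    where
    j : Fin (m C)
    j = fromℕ< r<m
    at-k : at k ≡ vtx C (inject₁ j)
    at-k = at≡vtx k (inject₁ j) (Eq.sym (trans (toℕ-inject₁ j) (toℕ-fromℕ< r<m)))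
    at-suc-k : at (suc k) ≡ vtx C (fsuc j)
    at-suc-k = at≡vtx (suc k) (fsuc j) (begin
      suc k % len C              ≡⟨ [1+m]%n≡[1+m%n]%n k (len C) ⟩
      suc (k % len C) % len C    ≡⟨ m≤n⇒m%n≡m r<m ⟩
      suc (k % len C)            ≡⟨ cong suc (Eq.sym (toℕ-fromℕ< r<m)) ⟩
      suc (toℕ j)                ∎)
      where open ≡-Reasoning
  ... | no r≮m = subst₂ (Adj G) (Eq.sym at-k) (Eq.sym at-suc-k) (close C)
    where
    r≡m : k % len C ≡ m C
    r≡m = ≤-antisym (s≤s⁻¹ (m%n<n k (len C))) (≮⇒≥ r≮m)
    at-k : at k ≡ vtx C (fromℕ (m C))
    at-k = at≡vtx k (fromℕ (m C)) (trans r≡m (Eq.sym (toℕ-fromℕ (m C))))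
    at-suc-k : at (suc k) ≡ vtx C fzero
    at-suc-k = at≡vtx (suc k) fzero (begin
      suc k % len C              ≡⟨ [1+m]%n≡[1+m%n]%n k (len C) ⟩
      suc (k % len C) % len C    ≡⟨ cong (λ y → suc y % len C) r≡m ⟩
      len C % len C              ≡⟨ n%n≡0 (len C) ⟩
      0                          ∎)
      where open ≡-Reasoning

  around : ℕ → V
  around k = at (k + toℕ i)

  around-0 : around 0 ≡ vtx C i
  around-0 = at≡vtx (toℕ i) i (m<n⇒m%n≡m (toℕ<n i))

  around-len : around (len C) ≡ vtx C i
  around-len = at≡vtx (len C + toℕ i) i (trans (cong (_% len C) (+-comm (len C) (toℕ i)))
                          (trans ([m+n]%n≡m%n (toℕ i) (len C)) (m<n⇒m%n≡m (toℕ<n i))))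

  around-surjective : ∀ j → ∃[ p ] p < len C × around p ≡ vtx C j
  around-surjective j with toℕ i ≤? toℕ j
  ... | yes a≤b = toℕ j ∸ toℕ i , ≤-<-trans (m∸n≤m (toℕ j) (toℕ i)) (toℕ<n j) ,
                  at≡vtx (toℕ j ∸ toℕ i + toℕ i) j (trans (cong (_% len C) (m∸n+n≡m a≤b)) (m<n⇒m%n≡m (toℕ<n j)))
  ... | no a≰b = toℕ j + (len C ∸ toℕ i) , wrapped< , at≡vtx (toℕ j + (len C ∸ toℕ i) + toℕ i) j wrapped%
    where
    a≤L : toℕ i ≤ len C
    a≤L = <⇒≤ (toℕ<n i)
    wrapped< : toℕ j + (len C ∸ toℕ i) < len C
    wrapped< = subst (toℕ j + (len C ∸ toℕ i) <_) (m+[n∸m]≡n a≤L) (+-monoˡ-< (len C ∸ toℕ i) (≰⇒> a≰b))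
    wrapped% : (toℕ j + (len C ∸ toℕ i) + toℕ i) % len C ≡ toℕ j
    wrapped% = begin
      (toℕ j + (len C ∸ toℕ i) + toℕ i) % len C    ≡⟨ cong (_% len C) (+-assoc (toℕ j) _ (toℕ i)) ⟩
      (toℕ j + ((len C ∸ toℕ i) + toℕ i)) % len C  ≡⟨ cong (λ y → (toℕ j + y) % len C) (m∸n+n≡m a≤L) ⟩
      (toℕ j + len C) % len C                      ≡⟨ [m+n]%n≡m%n (toℕ j) (len C) ⟩
      toℕ j % len C                                ≡⟨ m<n⇒m%n≡m (toℕ<n j) ⟩
      toℕ j                                        ∎
      where open ≡-Reasoning

  along : ∀ p k → Walk G (around p) (around (k + p)) k
  along p zero = nil
  along p (suc k) = along p k ∷ʳ at-adj (k + p + toℕ i)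

  segment : ∀ {p q} → p ≤ q → Walk G (around p) (around q) (q ∸ p)
  segment {p} {q} p≤q = subst (λ y → Walk G (around p) (around y) (q ∸ p)) (m∸n+n≡m p≤q) (along p (q ∸ p))

isOdd : Parity → Bool
isOdd 0ℙ = false
isOdd 1ℙ = true

isOdd-injective : ∀ {p q} → isOdd p ≡ isOdd q → p ≡ q
isOdd-injective {0ℙ} {0ℙ} _ = refl
isOdd-injective {1ℙ} {1ℙ} _ = refl

module OutsideBall {n : ℕ} (G : SimpleGraph (Fin n)) (C : Cycle G)
  (shortest : ∀ (D : Cycle G) → Odd (len D) → len C ≤ len D)
  (t : ℕ) (near : ∀ v → DistSetLe G (OnCycle G C) v t) (i : Fin (len C)) where

  open Walks G
  open Paths G Fin._≟_
  open Unrolling C i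

  z : Fin n
  z = vtx C i

  A R : Fin n → Set
  A a = OnCycle G C a × DistLe G z a t
  R v = DistSetLe G A v t

  foot : Fin n → Fin n
  foot v = proj₁ (near v)

  foot-onCycle : ∀ v → OnCycle G C (foot v)
  foot-onCycle v = proj₁ (proj₂ (near v))

  depth : Fin n → ℕ
  depth v = proj₁ (proj₂ (proj₂ (near v)))

  depth≤t : ∀ v → depth v ≤ t
  depth≤t v = proj₁ (proj₂ (proj₂ (proj₂ (near v))))

  leg : ∀ v → Walk G (foot v) v (depth v)
  leg v = proj₂ (proj₂ (proj₂ (proj₂ (near v))))

  position : Fin n → ℕ
  position v = proj₁ (around-surjective (proj₁ (foot-onCycle v)))

  position<len : ∀ v → position v < len C
  position<len v = proj₁ (proj₂ (around-surjective (proj₁ (foot-onCycle v))))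

  around-position : ∀ v → around (position v) ≡ foot v
  around-position v = trans (proj₂ (proj₂ (around-surjective (proj₁ (foot-onCycle v))))) (proj₂ (foot-onCycle v))

  close-foot⇒R : ∀ v {k} → k ≤ t → Walk G z (foot v) k → R v
  close-foot⇒R v k≤t w = foot v , (foot-onCycle v , _ , k≤t , w) , depth v , depth≤t v , leg v

  ¬R⇒t<position : ∀ v → ¬ R v → t < position v
  ¬R⇒t<position v v∉R with position v ≤? t
  ... | no p≰t = ≰⇒> p≰t
  ... | yes p≤t = ⊥-elim (v∉R (close-foot⇒R v p≤t
                    (subst₂ (λ a b → Walk G a b (position v)) around-0 (around-position v) (segment z≤n))))

  ¬R⇒position+t<len : ∀ v → ¬ R v → position v + t < len C
  ¬R⇒position+t<len v v∉R with len C ≤? position v + t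
  ... | no L≰p+t = ≰⇒> L≰p+t
  ... | yes L≤p+t = ⊥-elim (v∉R (close-foot⇒R v (m≤n+o⇒m∸n≤o (len C) (position v) L≤p+t)
                      (reverse (subst₂ (λ a b → Walk G a b (len C ∸ position v)) (around-position v) around-len
                                 (segment (<⇒≤ (position<len v)))))))

  colour : Fin n → Parity
  colour v = parity (position v + depth v)

  no-monochromatic-edge : ∀ u v → ¬ R u → ¬ R v → Adj G u v → position u ≤ position v → colour u ≢ colour v
  no-monochromatic-edge u v u∉R v∉R e pu≤pv same =
    let (D , odd , D≤detour) = closedWalk⇒oddCycle detour detour-odd
    in <-irrefl refl (<-≤-trans detour<len (≤-trans (shortest D odd) D≤detour))
    where
    x : ℕ
    x = position v ∸ position u
    x+pu≡pv : x + position u ≡ position v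
    x+pu≡pv = m∸n+n≡m pu≤pv
    detour : Walk G (foot u) (foot u) (x + (depth v + suc (depth u)))
    detour = subst₂ (λ a b → Walk G a b x) (around-position u) (around-position v) (segment pu≤pv)
             ++ leg v ++ cons (sym G e) (reverse (leg u))
    detour-odd : parity (x + (depth v + suc (depth u))) ≡ 1ℙ
    detour-odd = parity-detour≡1ℙ (position u) x (depth u) (depth v)
                   (trans same (cong (λ y → parity (y + depth v)) (Eq.sym x+pu≡pv)))
    detour<len : x + (depth v + suc (depth u)) < len C
    detour<len = detour-length< x+pu≡pv (¬R⇒t<position u u∉R) (¬R⇒position+t<len v v∉R) (depth≤t u) (depth≤t v)

  outside-bipartite : Bipartite (deleteSet G R)
  outside-bipartite = (λ (v , _) → isOdd (colour v)) , proper
    where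
    proper : ∀ (p q : Σ (Fin n) (λ v → ¬ R v)) → Adj G (proj₁ p) (proj₁ q) →
             isOdd (colour (proj₁ p)) ≢ isOdd (colour (proj₁ q))
    proper (u , u∉R) (v , v∉R) e same with ≤-total (position u) (position v)
    ... | inj₁ pu≤pv = no-monochromatic-edge u v u∉R v∉R e pu≤pv (isOdd-injective same)
    ... | inj₂ pv≤pu = no-monochromatic-edge v u v∉R u∉R (sym G e) pv≤pu (isOdd-injective (Eq.sym same))

lemma2 : (g : ℕ) → Odd g →
    (n : ℕ) (G : SimpleGraph (Fin n)) → OddGirth≥ G g →
    (C : Cycle G) → ShortestOddCycle G C →
    (t : ℕ) → t ≤ (g ∸ 1) / 2 →
    (∀ (v : Fin n) → DistSetLe G (OnCycle G C) v t) →
    (i : Fin (len C)) →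
    let z = vtx C i
        A = λ (a : Fin n) → OnCycle G C a × DistLe G z a t
        R = λ (v : Fin n) → DistSetLe G A v t
    in Bipartite (deleteSet G R)
lemma2 _ _ n G _ C (_ , shortest) t _ near i = OutsideBall.outside-bipartite G C shortest t near i
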